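{- Let $f,g\in Sym$ be symmetric functions of degree at most some positive integer $n$. If $f[\Xi_\mu]=g[\Xi_\mu]$ for all partitions $\mu$ with $|\mu|\ge n$, then $f=g$ in $Sym$.
   Context: $Sym=\mathbb{Q}[p_1,p_2,\dots]$ is the ring of symmetric functions, with $\deg p_k=k$. For $k\ge1$, $\Xi_k$ is the multiset $1,e^{2\pi i/k},\dots,e^{2(k-1)\pi i/k}$, for a partition $\mu$, $\Xi_\mu$ is the multiset union of $\Xi_{\mu_1},\dots,\Xi_{\mu_{\ell(\mu)}}$, and $f[\Xi_\mu]$ is obtained by replacing each $p_k$ in $f$ by the sum of the $k$-th powers of the elements of $\Xi_\mu$. -}

module Defs where

open import Data.Nat as ℕ using (ℕ; zero; suc; _≥_; _>_; _<_)
open import Data.Nat.Divisibility using (_∣?_)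
open import Data.Integer using (+_)
open import Data.Rational using (ℚ; 0ℚ; 1ℚ; _+_; _*_; _/_)
open import Data.List using (List; []; _∷_; foldr)
open import Data.List.Relation.Unary.All using (All)
open import Data.List.Properties using (≡-dec)
open import Data.Product using (_×_; _,_)
open import Relation.Binary.PropositionalEquality using (_≡_)
open import Relation.Nullary using (yes; no)

data Decreasing : List ℕ → Set where
  []  : Decreasing []
  [-] : ∀ {x} → Decreasing (x ∷ [])
  _∷_ : ∀ {x y ys} → x ≥ y → Decreasing (y ∷ ys) → Decreasing (x ∷ y ∷ ys)

record Partition : Set where
  constructor mkPartition
  field
    parts      : List ℕ
    positive   : All (λ x → 0 < x) parts
    decreasing : Decreasing parts
open Partition public

sumℕ : List ℕ → ℕ
sumℕ = foldr ℕ._+_ 0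

size : Partition → ℕ
size λ′ = sumℕ (parts λ′)

toℚ : ℕ → ℚ
toℚ n = (+ n) / 1

-- Sym = ℚ[p₁,p₂,…]: an element is a finite formal ℚ-linear combination
-- of the monomials p_λ = p_{λ₁} ⋯ p_{λℓ} (λ a partition).
Sym : Set
Sym = List (ℚ × Partition)

coeff : Sym → Partition → ℚ
coeff [] λ′ = 0ℚ
coeff ((q , ν) ∷ f) λ′ with ≡-dec ℕ._≟_ (parts ν) (parts λ′)
... | yes _ = q + coeff f λ′
... | no  _ = coeff f λ′

_≈Sym_ : Sym → Sym → Set
f ≈Sym g = ∀ λ′ → coeff f λ′ ≡ coeff g λ′

-- f has degree at most n (deg p_k = k)
DegreeAtMost : ℕ → Sym → Set
DegreeAtMost n f = ∀ λ′ → size λ′ > n → coeff f λ′ ≡ 0ℚ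

-- sum of k-th powers of the m-th roots of unity Ξ_m:
-- Σ_{j<m} e^{2πijk/m} = m if m ∣ k, and 0 otherwise.
powerSumΞ : ℕ → ℕ → ℚ
powerSumΞ k m with m ∣? k
... | yes _ = toℚ m
... | no  _ = 0ℚ

-- p_k[Ξ_μ]: Ξ_μ is the multiset union of the Ξ_{μᵢ}
pΞ : ℕ → Partition → ℚ
pΞ k μ = foldr (λ m acc → powerSumΞ k m + acc) 0ℚ (parts μ)

pλΞ : Partition → Partition → ℚ
pλΞ λ′ μ = foldr (λ k acc → pΞ k μ * acc) 1ℚ (parts λ′)

evalΞ : Sym → Partition → ℚ
evalΞ [] μ = 0ℚ
evalΞ ((q , λ′) ∷ f) μ = q * pλΞ λ′ μ + evalΞ f μ

{-# OPTIONS --safe #-}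
-- Write h = f - g as a polynomial in p₁, …, p_N. Inserting a part N+1 into μ leaves
-- p_k[Ξ_μ] unchanged for k ≤ N and raises p_(N+1)[Ξ_μ] by N+1, so among the partitions
-- with |μ| ≥ n the value of p_(N+1) runs through infinitely many points while p₁, …, p_N
-- stay fixed. A one-variable polynomial with infinitely many roots is zero, hence each
-- coefficient of h with respect to p_(N+1) vanishes on all partitions with |μ| ≥ n, and
-- induction on N gives h = 0.

module Submission where

open import Defs
open import Data.Nat using (ℕ; _≥_)
open import Relation.Binary.PropositionalEquality using (_≡_)

open import Algebra.Structures using (IsCommutativeMonoid)
open import Data.Empty using (⊥-elim)
open import Data.List using (List; []; _∷_; _++_; foldr; length; map)
open import Data.List.Properties using (map-cong; foldr-map; ≡-dec)
open import Data.List.Relation.Binary.Permutation.Propositional using (_↭_; ↭-sym; ↭⇒↭ₛ)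
import Data.List.Relation.Binary.Permutation.Propositional.Properties as Perm
import Data.List.Relation.Binary.Permutation.Setoid.Properties as PermSetoid
open import Data.List.Relation.Unary.All using (All; []; _∷_)
import Data.List.Relation.Unary.All as All
import Data.List.Relation.Unary.All.Properties as All
open import Data.List.Relation.Unary.Linked using (Linked; []; [-]; _∷_)
open import Data.Nat as ℕ using (zero; suc; _≤′_; ≤′-refl; ≤′-step)
open import Data.Nat.Divisibility using (_∣_; _∣?_; ∣⇒≤; ∣-refl)
open import Data.Nat.GeneralisedArithmetic using (fold)
open import Data.Nat.ListAction.Properties using (sum-↭)
import Data.Nat.Properties as ℕP
open import Data.Product using (Σ-syntax; _×_; _,_; proj₁; proj₂; map₁)
open import Data.Rational as ℚ using (ℚ; 0ℚ; 1ℚ; _+_; _*_; -_; _-_; 1/_)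
import Data.Rational.Properties as ℚP
open import Data.Rational.Solver using (module +-*-Solver)
open import Function using (_∘_)
open import Function.Definitions using (Injective)
open import Relation.Binary.Definitions using (tri<; tri≈; tri>)
import Relation.Binary.Construct.Flip.Ord as Flip
import Relation.Binary.PropositionalEquality as ≡
open import Relation.Binary.PropositionalEquality
  using (refl; sym; trans; cong; cong₂; subst; _≢_; module ≡-Reasoning)
open import Relation.Nullary using (yes; no; ¬_)

open import Algebra.Properties.Group ℚP.+-0-group using (x∙y⁻¹≈ε⇒x≈y)
open import Data.List.Sort.InsertionSort.Base (Flip.decTotalOrder ℕP.≤-decTotalOrder)
  using (insert)
open import Data.List.Sort.InsertionSort.Properties (Flip.decTotalOrder ℕP.≤-decTotalOrder)
  using (insert-↭; insert-↗)
open +-*-Solver using (solve; _:=_; _:+_; _:*_; _:-_; con)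

p*q≡0⇒q≡0 : ∀ p q .{{_ : ℚ.NonZero p}} → p * q ≡ 0ℚ → q ≡ 0ℚ
p*q≡0⇒q≡0 p q pq≡0 = begin
  q               ≡⟨ ℚP.*-identityˡ q ⟨
  1ℚ * q          ≡⟨ cong (_* q) (ℚP.*-inverseˡ p) ⟨
  (1/ p * p) * q  ≡⟨ ℚP.*-assoc (1/ p) p q ⟩
  1/ p * (p * q)  ≡⟨ cong (1/ p *_) pq≡0 ⟩
  1/ p * 0ℚ       ≡⟨ ℚP.*-zeroʳ (1/ p) ⟩
  0ℚ              ∎
  where open ≡-Reasoning

increasing⇒strictlyMonotone : (r : ℕ → ℚ) → (∀ i → r i ℚ.< r (suc i)) →
                              ∀ {i j} → suc i ≤′ j → r i ℚ.< r j
increasing⇒strictlyMonotone r r<r′ ≤′-refl        = r<r′ _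
increasing⇒strictlyMonotone r r<r′ (≤′-step i<j) =
  ℚP.<-trans (increasing⇒strictlyMonotone r r<r′ i<j) (r<r′ _)

increasing⇒injective : (r : ℕ → ℚ) → (∀ i → r i ℚ.< r (suc i)) → Injective _≡_ _≡_ r
increasing⇒injective r r<r′ {i} {j} ri≡rj with ℕP.<-cmp i j
... | tri< i<j _ _ = ⊥-elim (ℚP.<-irrefl ri≡rj (increasing⇒strictlyMonotone r r<r′ (ℕP.<⇒<′ i<j)))
... | tri≈ _ i≡j _ = i≡j
... | tri> _ _ j<i = ⊥-elim (ℚP.<-irrefl (sym ri≡rj) (increasing⇒strictlyMonotone r r<r′ (ℕP.<⇒<′ j<i)))

horner : List ℚ → ℚ → ℚ
horner []       x = 0ℚ
horner (a ∷ as) x = a + x * horner as x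

AllZero : List ℚ → Set
AllZero = All (_≡ 0ℚ)

-- Synthetic division by x - r: the quotient's coefficients are the values at r of the
-- proper suffixes of the coefficient list.
quotient : List ℚ → ℚ → List ℚ
quotient []           r = []
quotient (_ ∷ [])     r = []
quotient (_ ∷ b ∷ bs) r = horner (b ∷ bs) r ∷ quotient (b ∷ bs) r

length-quotient : ∀ a as r → length (quotient (a ∷ as) r) ≡ length as
length-quotient a []       r = refl
length-quotient a (b ∷ bs) r = cong suc (length-quotient b bs r)

horner-quotient : ∀ as r x → (x - r) * horner (quotient as r) x ≡ horner as x - horner as r
horner-quotient []           r x = solve 2 (λ r x → (x :- r) :* con 0ℚ := con 0ℚ :- con 0ℚ) refl r x
horner-quotient (a ∷ [])     r x =
  solve 3 (λ a r x → (x :- r) :* con 0ℚ := (a :+ x :* con 0ℚ) :- (a :+ r :* con 0ℚ)) refl a r x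
horner-quotient (a ∷ b ∷ bs) r x = begin
  (x - r) * (Br + x * Qx)
    ≡⟨ solve 4 (λ r x Br Qx → (x :- r) :* (Br :+ x :* Qx) := (x :- r) :* Br :+ x :* ((x :- r) :* Qx))
               refl r x Br Qx ⟩
  (x - r) * Br + x * ((x - r) * Qx)
    ≡⟨ cong (λ t → (x - r) * Br + x * t) (horner-quotient (b ∷ bs) r x) ⟩
  (x - r) * Br + x * (Bx - Br)
    ≡⟨ solve 5 (λ a r x Bx Br → (x :- r) :* Br :+ x :* (Bx :- Br) := (a :+ x :* Bx) :- (a :+ r :* Br))
               refl a r x Bx Br ⟩
  (a + x * Bx) - (a + r * Br)         ∎
  where
  open ≡-Reasoning
  Bx = horner (b ∷ bs) x
  Br = horner (b ∷ bs) r
  Qx = horner (quotient (b ∷ bs) r) x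

root∧quotient-zero⇒zero : ∀ as r → horner as r ≡ 0ℚ → AllZero (quotient as r) → AllZero as
root∧quotient-zero⇒zero []           r _    _             = []
root∧quotient-zero⇒zero (a ∷ [])     r root _             =
  trans (solve 2 (λ a r → a := a :+ r :* con 0ℚ) refl a r) root ∷ []
root∧quotient-zero⇒zero (a ∷ b ∷ bs) r root (Br≡0 ∷ rest) =
  a≡0 ∷ root∧quotient-zero⇒zero (b ∷ bs) r Br≡0 rest
  where
  a≡0 : a ≡ 0ℚ
  a≡0 = begin
    a                           ≡⟨ solve 2 (λ a r → a := a :+ r :* con 0ℚ) refl a r ⟩
    a + r * 0ℚ                  ≡⟨ cong (λ t → a + r * t) Br≡0 ⟨
    a + r * horner (b ∷ bs) r   ≡⟨ root ⟩
    0ℚ                          ∎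
    where open ≡-Reasoning

injective-roots⇒zero : ∀ as (r : ℕ → ℚ) → Injective _≡_ _≡_ r →
                       (∀ i → horner as (r i) ≡ 0ℚ) → AllZero as
injective-roots⇒zero as = by-length (length as) as refl
  where
  -- The quotient is shorter than the polynomial but not a subterm of it.
  by-length : ∀ d as → length as ≡ d → (r : ℕ → ℚ) → Injective _≡_ _≡_ r →
              (∀ i → horner as (r i) ≡ 0ℚ) → AllZero as
  by-length _       []       _      _ _     _     = []
  by-length (suc d) (a ∷ as) ∣as∣≡d r r-inj roots =
    root∧quotient-zero⇒zero (a ∷ as) (r 0) (roots 0)
      (by-length d (quotient (a ∷ as) (r 0))
                 (trans (length-quotient a as (r 0)) (ℕP.suc-injective ∣as∣≡d))
                 (r ∘ suc) (ℕP.suc-injective ∘ r-inj) quotient-roots)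
    where
    quotient-roots : ∀ i → horner (quotient (a ∷ as) (r 0)) (r (suc i)) ≡ 0ℚ
    quotient-roots i = p*q≡0⇒q≡0 (r (suc i) - r 0) _ {{ℚ.≢-nonZero ri-r0≢0}}
      (trans (horner-quotient (a ∷ as) (r 0) (r (suc i))) (cong₂ _-_ (roots (suc i)) (roots 0)))
      where
      ri-r0≢0 : r (suc i) - r 0 ≢ 0ℚ
      ri-r0≢0 = (λ ()) ∘ r-inj ∘ x∙y⁻¹≈ε⇒x≈y _ _

-- Polynomials in p₁, …, p_N in recursive dense form: an element of Poly (suc N) is the
-- list of its coefficients, in Poly N, with respect to the powers of p_(N+1).
Poly : ℕ → Set
Poly zero    = ℚ
Poly (suc N) = List (Poly N)

-- A point assigns the value x k to p_k; the coordinate x 0 is never read.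
evalP : ∀ {N} → Poly N → (ℕ → ℚ) → ℚ
evalP {zero}  q  x = q
evalP {suc N} cs x = horner (map (λ c → evalP c x) cs) (x (suc N))

IsZeroP : ∀ {N} → Poly N → Set
IsZeroP {zero}  q  = q ≡ 0ℚ
IsZeroP {suc N} cs = All IsZeroP cs

AgreeBelow : ℕ → (ℕ → ℚ) → (ℕ → ℚ) → Set
AgreeBelow N x y = ∀ {k} → k ℕ.< N → x (suc k) ≡ y (suc k)

evalP-agree : ∀ {N} (P : Poly N) {x y} → AgreeBelow N x y → evalP P x ≡ evalP P y
evalP-agree {zero}  q  _   = refl
evalP-agree {suc N} cs x≈y =
  cong₂ horner (map-cong (λ c → evalP-agree c (x≈y ∘ ℕP.m<n⇒m<1+n)) cs) (x≈y (ℕP.n<1+n N))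

VariesFreely : {I : Set} → (I → ℕ → ℚ) → Set
VariesFreely {I} point = ∀ N i → Σ[ move ∈ (ℕ → I) ]
  (∀ m → AgreeBelow N (point i) (point (move m))) × Injective _≡_ _≡_ (λ m → point (move m) (suc N))

vanishing⇒isZero : {I : Set} (point : I → ℕ → ℚ) → VariesFreely point → I →
                   ∀ {N} (P : Poly N) → (∀ i → evalP P (point i) ≡ 0ℚ) → IsZeroP P
vanishing⇒isZero point varies i₀ {zero}  q  vanish = vanish i₀
vanishing⇒isZero point varies i₀ {suc N} cs vanish = All.tabulate λ c∈cs →
  vanishing⇒isZero point varies i₀ _ λ i → All.lookup (coefficients-vanish i) c∈cs
  where
  coefficients-vanish : ∀ i → All (λ c → evalP c (point i) ≡ 0ℚ) cs
  coefficients-vanish i with varies N i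
  ... | move , agree , move-injective =
    All.map⁻ (injective-roots⇒zero _ (λ m → point (move m) (suc N)) move-injective λ m →
      trans (cong (λ as → horner as (point (move m) (suc N)))
                  (map-cong (λ c → evalP-agree c (agree m)) cs))
            (vanish (move m)))

zeroP : ∀ {N} → Poly N
zeroP {zero}  = 0ℚ
zeroP {suc N} = []

infixl 6 _+P_
_+P_ : ∀ {N} → Poly N → Poly N → Poly N
_+P_ {zero}  p        q        = p + q
_+P_ {suc N} []       qs       = qs
_+P_ {suc N} (p ∷ ps) []       = p ∷ ps
_+P_ {suc N} (p ∷ ps) (q ∷ qs) = p +P q ∷ ps +P qs

monomial : List ℕ → (ℕ → ℚ) → ℚ
monomial ws x = foldr (λ w acc → x w * acc) 1ℚ ws

-- Here and below the recursion along the list runs in a helper with N fixed: through a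
-- with-clause the termination checker loses the lexicographic descent in (N, list).
monomialP : ∀ {N} → ℚ → List ℕ → Poly N
monomialP {zero}  q _ = q
monomialP {suc N} q   = byPowers
  where
  byPowers : List ℕ → Poly (suc N)
  byPowers []       = monomialP q [] ∷ []
  byPowers (w ∷ ws) with w ℕ.≟ suc N
  ... | yes _ = zeroP ∷ byPowers ws
  ... | no  _ = monomialP q (w ∷ ws) ∷ []

coeffP : ∀ {N} → Poly N → List ℕ → ℚ
coeffP {zero}  q = λ _ → q
coeffP {suc N}   = byPowers
  where
  byPowers : List (Poly N) → List ℕ → ℚ
  byPowers []       _        = 0ℚ
  byPowers (c ∷ cs) []       = coeffP c []
  byPowers (c ∷ cs) (w ∷ ws) with w ℕ.≟ suc N
  ... | yes _ = byPowers cs ws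
  ... | no  _ = coeffP c (w ∷ ws)

data BoundedPartition : ℕ → List ℕ → Set where
  []   : ∀ {N} → BoundedPartition N []
  part : ∀ {N w ws} → 0 ℕ.< w → w ℕ.≤ N → BoundedPartition w ws → BoundedPartition N (w ∷ ws)

bounded-zero : ∀ {ws} → BoundedPartition 0 ws → ws ≡ []
bounded-zero []               = refl
bounded-zero (part 0<w w≤0 _) = ⊥-elim (ℕP.<⇒≱ 0<w w≤0)

bounded-≢ : ∀ {N w ws} → BoundedPartition (suc N) (w ∷ ws) → w ≢ suc N → BoundedPartition N (w ∷ ws)
bounded-≢ (part 0<w w≤1+N ws≤w) w≢1+N = part 0<w (ℕP.≤-pred (ℕP.≤∧≢⇒< w≤1+N w≢1+N)) ws≤w

evalP-zeroP : ∀ {N} x → evalP (zeroP {N}) x ≡ 0ℚ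
evalP-zeroP {zero}  x = refl
evalP-zeroP {suc N} x = refl

evalP-+P : ∀ {N} (P Q : Poly N) x → evalP (P +P Q) x ≡ evalP P x + evalP Q x
evalP-+P {zero}  p        q        x = refl
evalP-+P {suc N} []       qs       x = sym (ℚP.+-identityˡ _)
evalP-+P {suc N} (p ∷ ps) []       x = sym (ℚP.+-identityʳ _)
evalP-+P {suc N} (p ∷ ps) (q ∷ qs) x = begin
  evalP (p +P q) x + X * evalP (ps +P qs) x
    ≡⟨ cong₂ (λ s t → s + X * t) (evalP-+P p q x) (evalP-+P ps qs x) ⟩
  (evalP p x + evalP q x) + X * (evalP ps x + evalP qs x)
    ≡⟨ solve 5 (λ a b X c d → (a :+ b) :+ X :* (c :+ d) := (a :+ X :* c) :+ (b :+ X :* d)) refl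
               (evalP p x) (evalP q x) X (evalP ps x) (evalP qs x) ⟩
  (evalP p x + X * evalP ps x) + (evalP q x + X * evalP qs x) ∎
  where
  open ≡-Reasoning
  X = x (suc N)

evalP-monomialP : ∀ {N} q ws x → BoundedPartition N ws → evalP (monomialP {N} q ws) x ≡ q * monomial ws x
evalP-monomialP {zero}  q ws x ws≤0 rewrite bounded-zero ws≤0 = sym (ℚP.*-identityʳ q)
evalP-monomialP {suc N} q ws x = byPowers ws
  where
  X = x (suc N)

  constant : ∀ a → a + X * 0ℚ ≡ a
  constant a = solve 2 (λ a X → a :+ X :* con 0ℚ := a) refl a X

  byPowers : ∀ ws → BoundedPartition (suc N) ws → evalP (monomialP {suc N} q ws) x ≡ q * monomial ws x
  byPowers [] [] = trans (constant _) (evalP-monomialP {N} q [] x [])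
  byPowers (w ∷ ws) ws≤1+N@(part _ _ ws≤w) with w ℕ.≟ suc N
  ... | yes refl = begin
    evalP (zeroP {N}) x + X * evalP (monomialP {suc N} q ws) x
      ≡⟨ cong₂ (λ s t → s + X * t) (evalP-zeroP {N} x) (byPowers ws ws≤w) ⟩
    0ℚ + X * (q * monomial ws x)
      ≡⟨ solve 3 (λ X q m → con 0ℚ :+ X :* (q :* m) := q :* (X :* m)) refl X q (monomial ws x) ⟩
    q * (X * monomial ws x) ∎
    where open ≡-Reasoning
  ... | no w≢1+N = trans (constant _) (evalP-monomialP {N} q (w ∷ ws) x (bounded-≢ ws≤1+N w≢1+N))

coeffP-zeroP : ∀ {N} ws → coeffP (zeroP {N}) ws ≡ 0ℚ
coeffP-zeroP {zero}  ws = refl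
coeffP-zeroP {suc N} ws = refl

coeffP-+P : ∀ {N} (P Q : Poly N) ws → coeffP (P +P Q) ws ≡ coeffP P ws + coeffP Q ws
coeffP-+P {zero}  p q ws = refl
coeffP-+P {suc N}        = byPowers
  where
  byPowers : ∀ (ps qs : Poly (suc N)) ws → coeffP (ps +P qs) ws ≡ coeffP ps ws + coeffP qs ws
  byPowers []       qs       ws       = sym (ℚP.+-identityˡ _)
  byPowers (p ∷ ps) []       ws       = sym (ℚP.+-identityʳ _)
  byPowers (p ∷ ps) (q ∷ qs) []       = coeffP-+P p q []
  byPowers (p ∷ ps) (q ∷ qs) (w ∷ ws) with w ℕ.≟ suc N
  ... | yes _ = byPowers ps qs ws
  ... | no  _ = coeffP-+P p q (w ∷ ws)

coeffP-isZero : ∀ {N} (P : Poly N) ws → IsZeroP P → coeffP P ws ≡ 0ℚ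
coeffP-isZero {zero}  q ws q≡0 = q≡0
coeffP-isZero {suc N}          = byPowers
  where
  byPowers : ∀ (cs : Poly (suc N)) ws → IsZeroP cs → coeffP cs ws ≡ 0ℚ
  byPowers []       ws       _            = refl
  byPowers (c ∷ cs) []       (c≈0 ∷ _)    = coeffP-isZero c [] c≈0
  byPowers (c ∷ cs) (w ∷ ws) (c≈0 ∷ cs≈0) with w ℕ.≟ suc N
  ... | yes _ = byPowers cs ws cs≈0
  ... | no  _ = coeffP-isZero c (w ∷ ws) c≈0

-- Unfolding equations for coeffP, for goals where its argument only becomes a cons after
-- monomialP has been reduced by a case split (which with-abstraction does not look through).
coeffP-∷-top : ∀ {N} (c : Poly N) (cs : Poly (suc N)) ws →
               coeffP {suc N} (c ∷ cs) (suc N ∷ ws) ≡ coeffP cs ws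
coeffP-∷-top {N} c cs ws with suc N ℕ.≟ suc N
... | yes _      = refl
... | no 1+N≢1+N = ⊥-elim (1+N≢1+N refl)

coeffP-∷-other : ∀ {N} (c : Poly N) (cs : Poly (suc N)) {w} ws → w ≢ suc N →
                 coeffP {suc N} (c ∷ cs) (w ∷ ws) ≡ coeffP c (w ∷ ws)
coeffP-∷-other {N} c cs {w} ws w≢1+N with w ℕ.≟ suc N
... | yes w≡1+N = ⊥-elim (w≢1+N w≡1+N)
... | no _      = refl

coeffP-monomialP-≡ : ∀ {N} q ws → coeffP (monomialP {N} q ws) ws ≡ q
coeffP-monomialP-≡ {zero}  q ws = refl
coeffP-monomialP-≡ {suc N} q    = byPowers
  where
  byPowers : ∀ ws → coeffP (monomialP {suc N} q ws) ws ≡ q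
  byPowers []       = coeffP-monomialP-≡ {N} q []
  byPowers (w ∷ ws) with w ℕ.≟ suc N
  ... | yes refl = trans (coeffP-∷-top {N} zeroP (monomialP q ws) ws) (byPowers ws)
  ... | no w≢1+N = trans (coeffP-∷-other {N} (monomialP q (w ∷ ws)) [] ws w≢1+N)
                         (coeffP-monomialP-≡ {N} q (w ∷ ws))

coeffP-monomialP-≢ : ∀ {N} q {νs ws} → BoundedPartition N νs → BoundedPartition N ws → νs ≢ ws →
                     coeffP (monomialP {N} q νs) ws ≡ 0ℚ
coeffP-monomialP-≢ {zero}  q νs≤0 ws≤0 νs≢ws =
  ⊥-elim (νs≢ws (trans (bounded-zero νs≤0) (sym (bounded-zero ws≤0))))
coeffP-monomialP-≢ {suc N} q                 = byPowers
  where
  byPowers : ∀ {νs ws} → BoundedPartition (suc N) νs → BoundedPartition (suc N) ws → νs ≢ ws →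
             coeffP (monomialP {suc N} q νs) ws ≡ 0ℚ
  byPowers [] [] []≢[] = ⊥-elim ([]≢[] refl)
  byPowers {_} {w ∷ ws} [] ws≤1+N _ with w ℕ.≟ suc N
  ... | yes refl = refl
  ... | no w≢1+N = coeffP-monomialP-≢ {N} q [] (bounded-≢ ws≤1+N w≢1+N) λ ()
  byPowers {v ∷ νs} νs≤1+N [] _ with v ℕ.≟ suc N
  ... | yes _    = coeffP-zeroP {N} []
  ... | no v≢1+N = coeffP-monomialP-≢ {N} q (bounded-≢ νs≤1+N v≢1+N) [] λ ()
  byPowers {v ∷ νs} {w ∷ ws} νs≤1+N@(part _ _ νs≤v) ws≤1+N@(part _ _ ws≤w) νs≢ws
    with v ℕ.≟ suc N | w ℕ.≟ suc N
  ... | yes refl | yes refl = trans (coeffP-∷-top {N} zeroP (monomialP q νs) ws)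
                                    (byPowers νs≤v ws≤w (νs≢ws ∘ cong (suc N ∷_)))
  ... | yes _    | no w≢1+N = trans (coeffP-∷-other {N} zeroP (monomialP q νs) ws w≢1+N)
                                    (coeffP-zeroP {N} (w ∷ ws))
  ... | no _     | yes refl = coeffP-∷-top {N} (monomialP q (v ∷ νs)) [] ws
  ... | no v≢1+N | no w≢1+N = trans (coeffP-∷-other {N} (monomialP q (v ∷ νs)) [] ws w≢1+N)
    (coeffP-monomialP-≢ {N} q (bounded-≢ νs≤1+N v≢1+N) (bounded-≢ ws≤1+N w≢1+N) νs≢ws)

toPoly : ∀ {N} → Sym → Poly N
toPoly []            = zeroP
toPoly ((q , ν) ∷ h) = monomialP q (parts ν) +P toPoly h

BoundedSym : ℕ → Sym → Set
BoundedSym N = All (BoundedPartition N ∘ parts ∘ proj₂)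

pointΞ : Partition → ℕ → ℚ
pointΞ μ k = pΞ k μ

evalP-toPoly : ∀ {N} h μ → BoundedSym N h → evalP (toPoly {N} h) (pointΞ μ) ≡ evalΞ h μ
evalP-toPoly {N} []            μ []          = evalP-zeroP {N} (pointΞ μ)
evalP-toPoly {N} ((q , ν) ∷ h) μ (ν≤N ∷ h≤N) =
  trans (evalP-+P (monomialP {N} q (parts ν)) (toPoly h) (pointΞ μ))
        (cong₂ _+_ (evalP-monomialP {N} q (parts ν) (pointΞ μ) ν≤N) (evalP-toPoly h μ h≤N))

coeffP-toPoly : ∀ {N} h λ′ → BoundedSym N h → BoundedPartition N (parts λ′) →
                coeffP (toPoly {N} h) (parts λ′) ≡ coeff h λ′
coeffP-toPoly {N} []            λ′ []          _    = coeffP-zeroP {N} (parts λ′)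
coeffP-toPoly {N} ((q , ν) ∷ h) λ′ (ν≤N ∷ h≤N) λ′≤N
  rewrite coeffP-+P (monomialP {N} q (parts ν)) (toPoly h) (parts λ′)
  with ≡-dec ℕ._≟_ (parts ν) (parts λ′)
... | yes ν≡λ′ =
  cong₂ _+_ (subst (λ ws → coeffP (monomialP {N} q (parts ν)) ws ≡ q) ν≡λ′
                   (coeffP-monomialP-≡ {N} q (parts ν)))
            (coeffP-toPoly h λ′ h≤N λ′≤N)
... | no  ν≢λ′ =
  trans (cong₂ _+_ (coeffP-monomialP-≢ {N} q ν≤N λ′≤N ν≢λ′) (coeffP-toPoly h λ′ h≤N λ′≤N))
        (ℚP.+-identityˡ _)

largestPart : Partition → ℕ
largestPart (mkPartition []      _ _) = 0
largestPart (mkPartition (w ∷ _) _ _) = w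

partition-bounded : ∀ {N} μ → largestPart μ ℕ.≤ N → BoundedPartition N (parts μ)
partition-bounded (mkPartition []       _   _)   _   = []
partition-bounded (mkPartition (w ∷ ws) pos dec) w≤N = bounded pos dec w≤N
  where
  bounded : ∀ {N w ws} → All (0 ℕ.<_) (w ∷ ws) → Decreasing (w ∷ ws) → w ℕ.≤ N →
            BoundedPartition N (w ∷ ws)
  bounded (0<w ∷ [])  [-]         w≤N = part 0<w w≤N []
  bounded (0<w ∷ pos) (w≥v ∷ dec) w≤N = part 0<w w≤N (bounded pos dec w≥v)

maxLargestPart : Sym → ℕ
maxLargestPart = foldr (λ t m → largestPart (proj₂ t) ℕ.⊔ m) 0

sym-bounded : ∀ {N} h → maxLargestPart h ℕ.≤ N → BoundedSym N h
sym-bounded []            _     = []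
sym-bounded ((_ , ν) ∷ h) max≤N =
  partition-bounded ν (ℕP.m⊔n≤o⇒m≤o _ _ max≤N) ∷ sym-bounded h (ℕP.m⊔n≤o⇒n≤o _ _ max≤N)

decreasing⇒linked : ∀ {ws} → Decreasing ws → Linked _≥_ ws
decreasing⇒linked []          = []
decreasing⇒linked [-]         = [-]
decreasing⇒linked (w≥v ∷ dec) = w≥v ∷ decreasing⇒linked dec

linked⇒decreasing : ∀ {ws} → Linked _≥_ ws → Decreasing ws
linked⇒decreasing []          = []
linked⇒decreasing [-]         = [-]
linked⇒decreasing (w≥v ∷ lnk) = w≥v ∷ linked⇒decreasing lnk

foldr-↭ : {A : Set} {_∙_ : A → A → A} {ε : A} → IsCommutativeMonoid _≡_ _∙_ ε → (F : ℕ → A) →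
          ∀ {xs ys} → xs ↭ ys → foldr (λ m acc → F m ∙ acc) ε xs ≡ foldr (λ m acc → F m ∙ acc) ε ys
foldr-↭ {A} {_∙_} {ε} isCM F {xs} {ys} xs↭ys = begin
  foldr (λ m acc → F m ∙ acc) ε xs  ≡⟨ foldr-map _∙_ F ε xs ⟨
  foldr _∙_ ε (map F xs)            ≡⟨ foldr-commMonoid isCM (↭⇒↭ₛ (Perm.map⁺ F xs↭ys)) ⟩
  foldr _∙_ ε (map F ys)            ≡⟨ foldr-map _∙_ F ε ys ⟩
  foldr (λ m acc → F m ∙ acc) ε ys  ∎
  where
  open ≡-Reasoning
  open PermSetoid (≡.setoid A) using (foldr-commMonoid)

addPart : ∀ m .{{_ : ℕ.NonZero m}} → Partition → Partition
addPart m μ = mkPartition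
  (insert m (parts μ))
  (Perm.All-resp-↭ (↭-sym (insert-↭ m (parts μ))) (ℕ.>-nonZero⁻¹ m ∷ positive μ))
  (linked⇒decreasing (insert-↗ m (decreasing⇒linked (decreasing μ))))

size-addPart : ∀ m .{{_ : ℕ.NonZero m}} μ → size (addPart m μ) ≡ m ℕ.+ size μ
size-addPart m μ = sum-↭ (insert-↭ m (parts μ))

pΞ-addPart : ∀ k m .{{_ : ℕ.NonZero m}} μ → pΞ k (addPart m μ) ≡ powerSumΞ k m + pΞ k μ
pΞ-addPart k m μ = foldr-↭ ℚP.+-0-isCommutativeMonoid (powerSumΞ k) (insert-↭ m (parts μ))

powerSumΞ-∤ : ∀ {k m} → ¬ (m ∣ k) → powerSumΞ k m ≡ 0ℚ
powerSumΞ-∤ {k} {m} m∤k with m ∣? k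
... | yes m∣k = ⊥-elim (m∤k m∣k)
... | no  _   = refl

powerSumΞ-∣ : ∀ {k m} → m ∣ k → powerSumΞ k m ≡ toℚ m
powerSumΞ-∣ {k} {m} m∣k with m ∣? k
... | yes _   = refl
... | no  m∤k = ⊥-elim (m∤k m∣k)

0<toℚ-suc : ∀ m → 0ℚ ℚ.< toℚ (suc m)
0<toℚ-suc m = ℚP.positive⁻¹ (toℚ (suc m)) {{ℚP.normalize-pos (suc m) 1}}

large-partitions-vary : ∀ n → VariesFreely {Σ[ μ ∈ Partition ] size μ ≥ n} (pointΞ ∘ proj₁)
large-partitions-vary n N (μ , |μ|≥n) = (λ i → μs i , |μs|≥n i) , agree , increasing⇒injective r r<r′
  where
  μs : ℕ → Partition
  μs = fold μ (addPart (suc N))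

  |μs|≥n : ∀ i → size (μs i) ≥ n
  |μs|≥n zero    = |μ|≥n
  |μs|≥n (suc i) = ℕP.≤-trans (|μs|≥n i)
    (subst (size (μs i) ℕ.≤_) (sym (size-addPart (suc N) (μs i))) (ℕP.m≤n+m (size (μs i)) (suc N)))

  agree : ∀ i → AgreeBelow N (pointΞ μ) (pointΞ (μs i))
  agree zero    _       = refl
  agree (suc i) {k} k<N = begin
    pΞ (suc k) μ                                   ≡⟨ agree i k<N ⟩
    pΞ (suc k) (μs i)                              ≡⟨ ℚP.+-identityˡ _ ⟨
    0ℚ + pΞ (suc k) (μs i)                         ≡⟨ cong (_+ pΞ (suc k) (μs i)) (powerSumΞ-∤ 1+N∤1+k) ⟨
    powerSumΞ (suc k) (suc N) + pΞ (suc k) (μs i)  ≡⟨ pΞ-addPart (suc k) (suc N) (μs i) ⟨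
    pΞ (suc k) (μs (suc i))                        ∎
    where
    open ≡-Reasoning
    1+N∤1+k : ¬ (suc N ∣ suc k)
    1+N∤1+k = ℕP.<⇒≱ (ℕ.s<s k<N) ∘ ∣⇒≤

  r : ℕ → ℚ
  r i = pΞ (suc N) (μs i)

  r<r′ : ∀ i → r i ℚ.< r (suc i)
  r<r′ i = begin-strict
    r i                              ≡⟨ ℚP.+-identityˡ (r i) ⟨
    0ℚ + r i                         <⟨ ℚP.+-monoˡ-< (r i) (0<toℚ-suc N) ⟩
    toℚ (suc N) + r i                ≡⟨ cong (_+ r i) (powerSumΞ-∣ {suc N} ∣-refl) ⟨
    powerSumΞ (suc N) (suc N) + r i  ≡⟨ pΞ-addPart (suc N) (suc N) (μs i) ⟨
    r (suc i)                        ∎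
    where open ℚP.≤-Reasoning

vanishing-on-large⇒zero : ∀ n h → (∀ μ → size μ ≥ n → evalΞ h μ ≡ 0ℚ) → ∀ λ′ → coeff h λ′ ≡ 0ℚ
vanishing-on-large⇒zero n h vanish λ′ = begin
  coeff h λ′                        ≡⟨ coeffP-toPoly h λ′ h≤N λ′≤N ⟨
  coeffP (toPoly {N} h) (parts λ′)  ≡⟨ coeffP-isZero (toPoly h) (parts λ′) toPoly-isZero ⟩
  0ℚ                                ∎
  where
  open ≡-Reasoning
  N = maxLargestPart h ℕ.⊔ largestPart λ′
  h≤N  = sym-bounded h (ℕP.m≤m⊔n _ _)
  λ′≤N = partition-bounded λ′ (ℕP.m≤n⊔m _ _)

  large : Σ[ μ ∈ Partition ] size μ ≥ n
  large = mkPartition (suc n ∷ []) (ℕ.z<s ∷ []) [-] , ℕP.≤-trans (ℕP.n≤1+n n) (ℕP.m≤m+n (suc n) 0)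

  toPoly-isZero : IsZeroP (toPoly {N} h)
  toPoly-isZero = vanishing⇒isZero (pointΞ ∘ proj₁) (large-partitions-vary n) large (toPoly h)
    λ (μ , |μ|≥n) → trans (evalP-toPoly h μ h≤N) (vanish μ |μ|≥n)

negate : Sym → Sym
negate = map (map₁ (-_))

coeff-++ : ∀ f g λ′ → coeff (f ++ g) λ′ ≡ coeff f λ′ + coeff g λ′
coeff-++ []            g λ′ = sym (ℚP.+-identityˡ _)
coeff-++ ((q , ν) ∷ f) g λ′ with ≡-dec ℕ._≟_ (parts ν) (parts λ′)
... | yes _ = trans (cong (q +_) (coeff-++ f g λ′)) (sym (ℚP.+-assoc q _ _))
... | no  _ = coeff-++ f g λ′

coeff-negate : ∀ g λ′ → coeff (negate g) λ′ ≡ - coeff g λ′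
coeff-negate []            λ′ = refl
coeff-negate ((q , ν) ∷ g) λ′ with ≡-dec ℕ._≟_ (parts ν) (parts λ′)
... | yes _ = trans (cong (- q +_) (coeff-negate g λ′)) (sym (ℚP.neg-distrib-+ q _))
... | no  _ = coeff-negate g λ′

evalΞ-++ : ∀ f g μ → evalΞ (f ++ g) μ ≡ evalΞ f μ + evalΞ g μ
evalΞ-++ []            g μ = sym (ℚP.+-identityˡ _)
evalΞ-++ ((q , ν) ∷ f) g μ =
  trans (cong (q * pλΞ ν μ +_) (evalΞ-++ f g μ)) (sym (ℚP.+-assoc (q * pλΞ ν μ) (evalΞ f μ) (evalΞ g μ)))

evalΞ-negate : ∀ g μ → evalΞ (negate g) μ ≡ - evalΞ g μ
evalΞ-negate []            μ = refl
evalΞ-negate ((q , ν) ∷ g) μ = begin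
  - q * pλΞ ν μ + evalΞ (negate g) μ  ≡⟨ cong₂ _+_ (sym (ℚP.neg-distribˡ-* q _)) (evalΞ-negate g μ) ⟩
  - (q * pλΞ ν μ) + - evalΞ g μ       ≡⟨ ℚP.neg-distrib-+ (q * pλΞ ν μ) (evalΞ g μ) ⟨
  - (q * pλΞ ν μ + evalΞ g μ)         ∎
  where open ≡-Reasoning

corollary56 : (n : ℕ) → n ≥ 1 → (f g : Sym) →
    DegreeAtMost n f → DegreeAtMost n g →
    ((μ : Partition) → size μ ≥ n → evalΞ f μ ≡ evalΞ g μ) →
    f ≈Sym g
corollary56 n _ f g _ _ f≡g λ′ = x∙y⁻¹≈ε⇒x≈y (coeff f λ′) (coeff g λ′) (begin
  coeff f λ′ - coeff g λ′           ≡⟨ cong (coeff f λ′ +_) (coeff-negate g λ′) ⟨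
  coeff f λ′ + coeff (negate g) λ′  ≡⟨ coeff-++ f (negate g) λ′ ⟨
  coeff (f ++ negate g) λ′          ≡⟨ vanishing-on-large⇒zero n (f ++ negate g) difference-vanishes λ′ ⟩
  0ℚ                                ∎)
  where
  open ≡-Reasoning
  difference-vanishes : ∀ μ → size μ ≥ n → evalΞ (f ++ negate g) μ ≡ 0ℚ
  difference-vanishes μ |μ|≥n = begin
    evalΞ (f ++ negate g) μ         ≡⟨ evalΞ-++ f (negate g) μ ⟩
    evalΞ f μ + evalΞ (negate g) μ  ≡⟨ cong₂ _+_ (f≡g μ |μ|≥n) (evalΞ-negate g μ) ⟩
    evalΞ g μ - evalΞ g μ           ≡⟨ ℚP.+-inverseʳ (evalΞ g μ) ⟩
    0ℚ                              ∎
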